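{- Two low-defect expressions $E$ and $E'$ have isomorphic low-defect trees (isomorphism preserving root and all labels) if and only if $E'$ can be obtained from $E$ by a finite sequence of the following moves applied to subexpressions: (1) for low-defect expressions $E_1,E_2$, replace $E_1\cdot E_2$ by $E_2\cdot E_1$; (2) for low-defect expressions $E_1,E_2,E_3$, replace $(E_1\cdot E_2)\cdot E_3$ by $E_1\cdot(E_2\cdot E_3)$, or vice versa; (3) for integer constants $n,m$, replace $n\cdot m$ by the constant $nm$; and for an integer constant $k=mn$, replace $k$ by $m\cdot n$, the latter only if $k$ does not appear as an addend in a larger expression; (4) for a low-defect expression $E_1$, replace $1\cdot E_1$ by $E_1$, or vice versa; (5) rename all variables of the whole expression, keeping distinct variables distinct (applied only to the whole expression, not to subexpressions).
   Context: Low-defect expressions: (a) every positive integer constant is one; (b) the product of two low-defect expressions with disjoint variable sets is one; (c) if $E$ is one, $c$ a positive integer and $x$ a variable not in $E$, then $E\cdot x+c$ is one. The low-defect tree of an expression (a rooted tree with vertices and edges labeled by positive integers): for a constant $n$, a single vertex labeled $n$; for $E=E'\cdot x+c$ with tree $T'$, $T'$ with a new root labeled $1$ joined to the root of $T'$ by an edge labeled $c$; for $E=E_1\cdot E_2$ with trees $T_1,T_2$, remove both roots and add a new root labeled by the product of the old root labels, adjacent to all vertices formerly adjacent to either old root, edge labels kept. -}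

module Defs where

open import Data.Nat using (ℕ; _*_; NonZero)
open import Data.Product using (_×_; _,_)
open import Data.List using (List; []; _∷_; _++_)
open import Data.List.Membership.Propositional using (_∈_; _∉_)
open import Relation.Binary.PropositionalEquality using (_≡_)

-- Variables are named by natural numbers.
--   const n      : the integer constant n
--   E ⊗ F        : the product E · F
--   lin E x c    : the expression E · x + c   (x a variable, c a constant)
-- The addend c is a number (not a subexpression), so no move can act on it.

infixl 7 _⊗_

data Expr : Set where
  const : ℕ → Expr
  _⊗_   : Expr → Expr → Expr
  lin   : Expr → ℕ → ℕ → Expr

vars : Expr → List ℕ
vars (const n)   = []
vars (E ⊗ F)     = vars E ++ vars F
vars (lin E x c) = x ∷ vars E

data LowDefect : Expr → Set where
  ld-const : ∀ {n} → NonZero n → LowDefect (const n)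
  ld-mul   : ∀ {E F} → LowDefect E → LowDefect F →
             (∀ {x} → x ∈ vars E → x ∉ vars F) → LowDefect (E ⊗ F)
  ld-lin   : ∀ {E x c} → LowDefect E → NonZero c → x ∉ vars E →
             LowDefect (lin E x c)

-- Rooted trees with vertex labels and edge labels in ℕ.
-- node a cs : root labelled a, with children given as (edge label, subtree).
-- The order of the list of children is irrelevant up to isomorphism.

data Tree : Set where
  node : ℕ → List (ℕ × Tree) → Tree

treeMul : Tree → Tree → Tree
treeMul (node a cs) (node b ds) = node (a * b) (cs ++ ds)

tree : Expr → Tree
tree (const n)   = node n []
tree (E ⊗ F)     = treeMul (tree E) (tree F)
tree (lin E x c) = node 1 ((c , tree E) ∷ [])

-- Isomorphism of rooted labelled trees (preserving root, vertex labels
-- and edge labels): same root label, and a bijection between the children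
-- matching edge labels and with isomorphic subtrees.
data _≅_ : Tree → Tree → Set
data _≅ᶜ_ : List (ℕ × Tree) → List (ℕ × Tree) → Set

data _≅_ where
  node : ∀ {a cs ds} → cs ≅ᶜ ds → node a cs ≅ node a ds

data _≅ᶜ_ where
  []  : [] ≅ᶜ []
  _∷_ : ∀ {c t u cs ds₁ ds₂} → t ≅ u → cs ≅ᶜ (ds₁ ++ ds₂) →
        ((c , t) ∷ cs) ≅ᶜ (ds₁ ++ (c , u) ∷ ds₂)

data RootMove : Expr → Expr → Set where
  comm    : ∀ {E₁ E₂} → RootMove (E₁ ⊗ E₂) (E₂ ⊗ E₁)
  assoc   : ∀ {E₁ E₂ E₃} → RootMove ((E₁ ⊗ E₂) ⊗ E₃) (E₁ ⊗ (E₂ ⊗ E₃))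
  unassoc : ∀ {E₁ E₂ E₃} → RootMove (E₁ ⊗ (E₂ ⊗ E₃)) ((E₁ ⊗ E₂) ⊗ E₃)
  fuse    : ∀ {n m} → RootMove (const n ⊗ const m) (const (n * m))
  split   : ∀ {k m n} → k ≡ m * n → RootMove (const k) (const m ⊗ const n)
  unitElim  : ∀ {E₁} → RootMove (const 1 ⊗ E₁) E₁
  unitIntro : ∀ {E₁} → RootMove E₁ (const 1 ⊗ E₁)

-- Since addends are
-- not subexpressions (they are numbers), the side condition of (3) that a
-- split constant must not be an addend is built in.
data SubMove : Expr → Expr → Set where
  here  : ∀ {E F} → RootMove E F → SubMove E F
  left  : ∀ {E F G} → SubMove E F → SubMove (E ⊗ G) (F ⊗ G)
  right : ∀ {E F G} → SubMove E F → SubMove (G ⊗ E) (G ⊗ F)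
  under : ∀ {E F x c} → SubMove E F → SubMove (lin E x c) (lin F x c)

rename : (ℕ → ℕ) → Expr → Expr
rename ρ (const n)   = const n
rename ρ (E ⊗ F)     = rename ρ E ⊗ rename ρ F
rename ρ (lin E x c) = lin (rename ρ E) (ρ x) c

data Move : Expr → Expr → Set where
  sub    : ∀ {E F} → SubMove E F → Move E F
  renameAll : ∀ {E} (ρ : ℕ → ℕ) →
              (∀ {x y} → x ∈ vars E → y ∈ vars E → ρ x ≡ ρ y → x ≡ y) →
              Move E (rename ρ E)

-- Each move changes the low-defect tree only up to isomorphism. Conversely,
-- moves (1)–(4) bring every expression to a normal form n · ∏ (Nᵢ · xᵢ + cᵢ)
-- whose syntax mirrors its tree: root label n, one child per factor. Two
-- isomorphic normal-form trees are matched factor by factor (moves (1) and (2)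
-- reorder factors), recursively. Since a low-defect expression uses each
-- variable once, the variable correspondences found for the separate factors
-- glue into one renaming that is injective on the variables, so a single
-- application of move (5) at the start suffices.
module Submission where

open import Defs
open import Data.Empty using (⊥-elim)
open import Data.List using (List; []; _∷_; _++_)
import Data.List.Properties as List
open import Data.List.Membership.Propositional using (_∈_; _∉_)
open import Data.List.Membership.Propositional.Properties using (∈-++⁺ˡ; ∈-++⁺ʳ; ∈-++⁻)
open import Data.List.Relation.Binary.Permutation.Propositional.Properties using (++-comm)
open import Data.List.Relation.Binary.Subset.Propositional using (_⊆_)
open import Data.List.Relation.Binary.Subset.Propositional.Properties
  using (⊆-refl; ⊆-reflexive; ⊆-reflexive-↭; ∷⁺ʳ; ++⁺ˡ; ++⁺ʳ)
open import Data.List.Relation.Unary.Any using (here; there)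
open import Data.Nat using (ℕ; _*_; _≟_)
open import Data.Nat.Properties using (*-comm; *-assoc; *-identityˡ; m*n≢0; m*n≢0⇒m≢0; m*n≢0⇒n≢0)
open import Data.List.Membership.DecPropositional _≟_ using (_∈?_)
open import Data.Product using (_×_; _,_; ∃-syntax)
open import Data.Sum using (_⊎_; inj₁; inj₂; [_,_])
open import Function using (id; _∘_)
open import Function.Bundles using (_⇔_; mk⇔)
open import Relation.Binary.Construct.Closure.ReflexiveTransitive
  using (Star; ε; _◅_; _◅◅_; fold; gmap; map; return; reverse)
open import Relation.Binary.PropositionalEquality
  using (_≡_; refl; sym; trans; cong; cong₂; subst; subst₂; module ≡-Reasoning)
open import Relation.Nullary using (¬_; yes; no)

-- Isomorphism of labelled trees

≅-refl : ∀ T → T ≅ T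
≅ᶜ-refl : ∀ cs → cs ≅ᶜ cs
≅-refl (node a cs) = node (≅ᶜ-refl cs)
≅ᶜ-refl [] = []
≅ᶜ-refl ((c , t) ∷ cs) = _∷_ {ds₁ = []} (≅-refl t) (≅ᶜ-refl cs)

≅-reflexive : ∀ {T U} → T ≡ U → T ≅ U
≅-reflexive {T} refl = ≅-refl T

++-≡-++-∷-split : ∀ {A : Set} (f₁ f₂ g₁ g₂ : List A) x → f₁ ++ f₂ ≡ g₁ ++ x ∷ g₂ →
  (∃[ h ] f₁ ≡ g₁ ++ x ∷ h × g₂ ≡ h ++ f₂) ⊎ (∃[ h ] g₁ ≡ f₁ ++ h × f₂ ≡ h ++ x ∷ g₂)
++-≡-++-∷-split [] f₂ g₁ g₂ x eq = inj₂ (g₁ , refl , eq)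
++-≡-++-∷-split (a ∷ f₁) f₂ [] g₂ x refl = inj₁ (f₁ , refl , refl)
++-≡-++-∷-split (a ∷ f₁) f₂ (b ∷ g₁) g₂ x eq with List.∷-injective eq
... | refl , eq′ with ++-≡-++-∷-split f₁ f₂ g₁ g₂ x eq′
...   | inj₁ (h , e₁ , e₂) = inj₁ (h , cong (a ∷_) e₁ , e₂)
...   | inj₂ (h , e₁ , e₂) = inj₂ (h , cong (a ∷_) e₁ , e₂)

≅ᶜ-resp-≡ : ∀ {cs ds es} → ds ≡ es → cs ≅ᶜ ds → cs ≅ᶜ es
≅ᶜ-resp-≡ = subst (_ ≅ᶜ_)

≅ᶜ-remove : ∀ ds₁ {c u ds₂ es} → (ds₁ ++ (c , u) ∷ ds₂) ≅ᶜ es →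
  ∃[ es₁ ] ∃[ es₂ ] ∃[ v ] es ≡ es₁ ++ (c , v) ∷ es₂ × u ≅ v × (ds₁ ++ ds₂) ≅ᶜ (es₁ ++ es₂)
≅ᶜ-remove [] (u≅v ∷ p) = _ , _ , _ , refl , u≅v , p
≅ᶜ-remove (d ∷ ds₁) (_∷_ {c = c′} {u = u′} {ds₁ = f₁} {ds₂ = f₂} t≅u′ p) with ≅ᶜ-remove ds₁ p
... | g₁ , g₂ , v , eq , u≅v , q with ++-≡-++-∷-split f₁ f₂ g₁ g₂ _ eq
...   | inj₁ (h , refl , refl) =
  g₁ , h ++ (c′ , u′) ∷ f₂ , v , List.++-assoc g₁ (_ ∷ h) _ , u≅v ,
  ≅ᶜ-resp-≡ (List.++-assoc g₁ h _)
    (_∷_ {ds₁ = g₁ ++ h} t≅u′ (≅ᶜ-resp-≡ (sym (List.++-assoc g₁ h f₂)) q))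
...   | inj₂ (h , refl , refl) =
  f₁ ++ (c′ , u′) ∷ h , g₂ , v , sym (List.++-assoc f₁ (_ ∷ h) _) , u≅v ,
  ≅ᶜ-resp-≡ (sym (List.++-assoc f₁ (_ ∷ h) g₂))
    (_∷_ {ds₁ = f₁} t≅u′ (≅ᶜ-resp-≡ (List.++-assoc f₁ h g₂) q))

≅-trans : ∀ {T U V} → T ≅ U → U ≅ V → T ≅ V
≅ᶜ-trans : ∀ {cs ds es} → cs ≅ᶜ ds → ds ≅ᶜ es → cs ≅ᶜ es
≅-trans (node p) (node q) = node (≅ᶜ-trans p q)
≅ᶜ-trans [] q = q
≅ᶜ-trans (_∷_ {ds₁ = d₁} t≅u p) q with ≅ᶜ-remove d₁ q
... | e₁ , e₂ , v , refl , u≅v , r = _∷_ {ds₁ = e₁} (≅-trans t≅u u≅v) (≅ᶜ-trans p r)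

≅ᶜ-++ : ∀ {cs cs′ ds ds′} → cs ≅ᶜ cs′ → ds ≅ᶜ ds′ → (cs ++ ds) ≅ᶜ (cs′ ++ ds′)
≅ᶜ-++ [] q = q
≅ᶜ-++ {ds′ = ds′} (_∷_ {ds₁ = e₁} {ds₂ = e₂} t≅u p) q =
  ≅ᶜ-resp-≡ (sym (List.++-assoc e₁ (_ ∷ e₂) ds′))
    (_∷_ {ds₁ = e₁} t≅u (≅ᶜ-resp-≡ (List.++-assoc e₁ e₂ ds′) (≅ᶜ-++ p q)))

≅ᶜ-++-comm : ∀ cs ds → (cs ++ ds) ≅ᶜ (ds ++ cs)
≅ᶜ-++-comm [] ds = ≅ᶜ-resp-≡ (sym (List.++-identityʳ ds)) (≅ᶜ-refl ds)
≅ᶜ-++-comm ((c , t) ∷ cs) ds = _∷_ {ds₁ = ds} (≅-refl t) (≅ᶜ-++-comm cs ds)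

treeMul-congˡ : ∀ {T U} V → T ≅ U → treeMul T V ≅ treeMul U V
treeMul-congˡ (node b es) (node p) = node (≅ᶜ-++ p (≅ᶜ-refl es))

treeMul-congʳ : ∀ {T U} V → T ≅ U → treeMul V T ≅ treeMul V U
treeMul-congʳ (node b es) (node p) = node (≅ᶜ-++ (≅ᶜ-refl es) p)

treeMul-comm : ∀ T U → treeMul T U ≅ treeMul U T
treeMul-comm (node a cs) (node b ds) rewrite *-comm a b = node (≅ᶜ-++-comm cs ds)

treeMul-assoc : ∀ T U V → treeMul (treeMul T U) V ≡ treeMul T (treeMul U V)
treeMul-assoc (node a cs) (node b ds) (node c es) =
  cong₂ node (*-assoc a b c) (List.++-assoc cs ds es)

treeMul-identityˡ : ∀ T → treeMul (node 1 []) T ≡ T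
treeMul-identityˡ (node a cs) = cong (λ b → node b cs) (*-identityˡ a)

-- Moves preserve the tree

RootMove⇒≅ : ∀ {E F} → RootMove E F → tree E ≅ tree F
RootMove⇒≅ (comm {E₁} {E₂}) = treeMul-comm (tree E₁) (tree E₂)
RootMove⇒≅ (assoc {E₁} {E₂} {E₃}) = ≅-reflexive (treeMul-assoc (tree E₁) (tree E₂) (tree E₃))
RootMove⇒≅ (unassoc {E₁} {E₂} {E₃}) =
  ≅-reflexive (sym (treeMul-assoc (tree E₁) (tree E₂) (tree E₃)))
RootMove⇒≅ fuse = ≅-refl _
RootMove⇒≅ (split refl) = ≅-refl _
RootMove⇒≅ (unitElim {E₁}) = ≅-reflexive (treeMul-identityˡ (tree E₁))
RootMove⇒≅ (unitIntro {E₁}) = ≅-reflexive (sym (treeMul-identityˡ (tree E₁)))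

SubMove⇒≅ : ∀ {E F} → SubMove E F → tree E ≅ tree F
SubMove⇒≅ (here r) = RootMove⇒≅ r
SubMove⇒≅ (left {G = G} m) = treeMul-congˡ (tree G) (SubMove⇒≅ m)
SubMove⇒≅ (right {G = G} m) = treeMul-congʳ (tree G) (SubMove⇒≅ m)
SubMove⇒≅ (under m) = node (_∷_ {ds₁ = []} (SubMove⇒≅ m) [])

tree-rename : ∀ ρ E → tree (rename ρ E) ≡ tree E
tree-rename ρ (const n) = refl
tree-rename ρ (E ⊗ F) = cong₂ treeMul (tree-rename ρ E) (tree-rename ρ F)
tree-rename ρ (lin E x c) = cong (λ T → node 1 ((c , T) ∷ [])) (tree-rename ρ E)

Move⇒≅ : ∀ {E F} → Move E F → tree E ≅ tree F
Move⇒≅ (sub m) = SubMove⇒≅ m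
Move⇒≅ (renameAll {E} ρ _) = ≅-reflexive (sym (tree-rename ρ E))

Moves⇒≅ : ∀ {E F} → Star Move E F → tree E ≅ tree F
Moves⇒≅ = fold (λ E F → tree E ≅ tree F) (≅-trans ∘ Move⇒≅) (≅-refl _)

_⇝_ : Expr → Expr → Set
_⇝_ = Star SubMove

rootStep : ∀ {E F} → RootMove E F → E ⇝ F
rootStep = return ∘ here

⇝-⊗ˡ : ∀ {E F G} → E ⇝ F → (E ⊗ G) ⇝ (F ⊗ G)
⇝-⊗ˡ {G = G} = gmap (_⊗ G) left

⇝-⊗ʳ : ∀ {E F G} → E ⇝ F → (G ⊗ E) ⇝ (G ⊗ F)
⇝-⊗ʳ {G = G} = gmap (G ⊗_) right

⇝-lin : ∀ {E F x c} → E ⇝ F → lin E x c ⇝ lin F x c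
⇝-lin {x = x} {c} = gmap (λ E → lin E x c) under

RootMove-sym : ∀ {E F} → RootMove E F → RootMove F E
RootMove-sym comm = comm
RootMove-sym assoc = unassoc
RootMove-sym unassoc = assoc
RootMove-sym fuse = split refl
RootMove-sym (split refl) = fuse
RootMove-sym unitElim = unitIntro
RootMove-sym unitIntro = unitElim

SubMove-sym : ∀ {E F} → SubMove E F → SubMove F E
SubMove-sym (here r) = here (RootMove-sym r)
SubMove-sym (left m) = left (SubMove-sym m)
SubMove-sym (right m) = right (SubMove-sym m)
SubMove-sym (under m) = under (SubMove-sym m)

⇝-sym : ∀ {E F} → E ⇝ F → F ⇝ E
⇝-sym = reverse SubMove-sym

⇝⇒Moves : ∀ {E F} → E ⇝ F → Star Move E F
⇝⇒Moves = map sub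

RootMove-vars⊆ : ∀ {E F} → RootMove E F → vars E ⊆ vars F
RootMove-vars⊆ (comm {E₁} {E₂}) = ⊆-reflexive-↭ (++-comm (vars E₁) (vars E₂))
RootMove-vars⊆ (assoc {E₁} {E₂} {E₃}) = ⊆-reflexive (List.++-assoc (vars E₁) (vars E₂) (vars E₃))
RootMove-vars⊆ (unassoc {E₁} {E₂} {E₃}) =
  ⊆-reflexive (sym (List.++-assoc (vars E₁) (vars E₂) (vars E₃)))
RootMove-vars⊆ fuse ()
RootMove-vars⊆ (split _) ()
RootMove-vars⊆ unitElim = ⊆-refl
RootMove-vars⊆ unitIntro = ⊆-refl

SubMove-vars⊆ : ∀ {E F} → SubMove E F → vars E ⊆ vars F
SubMove-vars⊆ (here r) = RootMove-vars⊆ r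
SubMove-vars⊆ (left {G = G} m) = ++⁺ˡ (vars G) (SubMove-vars⊆ m)
SubMove-vars⊆ (right {G = G} m) = ++⁺ʳ (vars G) (SubMove-vars⊆ m)
SubMove-vars⊆ (under {x = x} m) = ∷⁺ʳ x (SubMove-vars⊆ m)

⇝-vars⊆ : ∀ {E F} → E ⇝ F → vars E ⊆ vars F
⇝-vars⊆ = fold (λ E F → vars E ⊆ vars F) (λ m p → p ∘ SubMove-vars⊆ m) id

Disjoint : Expr → Expr → Set
Disjoint E F = ∀ {x} → x ∈ vars E → x ∉ vars F

Disjoint-sym : ∀ {E F} → Disjoint E F → Disjoint F E
Disjoint-sym d x∈F x∈E = d x∈E x∈F

Disjoint-⊗ˡ : ∀ {E F G} → Disjoint E G → Disjoint F G → Disjoint (E ⊗ F) G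
Disjoint-⊗ˡ {E} d e x∈EF = [ d , e ] (∈-++⁻ (vars E) x∈EF)

Disjoint-⊗ʳ : ∀ {E F G} → Disjoint E F → Disjoint E G → Disjoint E (F ⊗ G)
Disjoint-⊗ʳ {F = F} d e x∈E x∈FG = [ d x∈E , e x∈E ] (∈-++⁻ (vars F) x∈FG)

LowDefect-RootMove : ∀ {E F} → RootMove E F → LowDefect E → LowDefect F
LowDefect-RootMove (comm {E₁} {E₂}) (ld-mul a b d) = ld-mul b a (Disjoint-sym {E₁} {E₂} d)
LowDefect-RootMove (assoc {E₁} {E₂} {E₃}) (ld-mul (ld-mul a b d₁₂) c d₁₂₃) =
  ld-mul a (ld-mul b c (d₁₂₃ ∘ ∈-++⁺ʳ (vars E₁))) (Disjoint-⊗ʳ {E₁} {E₂} {E₃} d₁₂ (d₁₂₃ ∘ ∈-++⁺ˡ))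
LowDefect-RootMove (unassoc {E₁} {E₂} {E₃}) (ld-mul a (ld-mul b c d₂₃) d₁₂₃) =
  ld-mul (ld-mul a b (λ x∈₁ x∈₂ → d₁₂₃ x∈₁ (∈-++⁺ˡ x∈₂))) c
    (Disjoint-⊗ˡ {E₁} {E₂} {E₃} (λ x∈₁ x∈₃ → d₁₂₃ x∈₁ (∈-++⁺ʳ (vars E₂) x∈₃)) d₂₃)
LowDefect-RootMove (fuse {n} {m}) (ld-mul (ld-const a) (ld-const b) _) =
  ld-const (m*n≢0 n m {{a}} {{b}})
LowDefect-RootMove (split {m = m} refl) (ld-const a) =
  ld-mul (ld-const (m*n≢0⇒m≢0 m {{a}})) (ld-const (m*n≢0⇒n≢0 m {{a}})) (λ ())
LowDefect-RootMove unitElim (ld-mul _ b _) = b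
LowDefect-RootMove unitIntro a = ld-mul (ld-const _) a (λ ())

LowDefect-SubMove : ∀ {E F} → SubMove E F → LowDefect E → LowDefect F
LowDefect-SubMove (here r) a = LowDefect-RootMove r a
LowDefect-SubMove (left m) (ld-mul a b d) =
  ld-mul (LowDefect-SubMove m a) b (d ∘ SubMove-vars⊆ (SubMove-sym m))
LowDefect-SubMove (right m) (ld-mul a b d) =
  ld-mul a (LowDefect-SubMove m b) (λ x∈ → d x∈ ∘ SubMove-vars⊆ (SubMove-sym m))
LowDefect-SubMove (under m) (ld-lin a c x∉) =
  ld-lin (LowDefect-SubMove m a) c (x∉ ∘ SubMove-vars⊆ (SubMove-sym m))

LowDefect-⇝ : ∀ {E F} → E ⇝ F → LowDefect E → LowDefect F
LowDefect-⇝ = fold (λ E F → LowDefect E → LowDefect F) (λ m p → p ∘ LowDefect-SubMove m) id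

-- Normal forms

data Normal : Set
data Factor : Set

data Normal where
  prod : ℕ → List Factor → Normal

data Factor where
  _·_+_ : Normal → ℕ → ℕ → Factor

treeᴺ : Normal → Tree
children : List Factor → List (ℕ × Tree)
treeᴺ (prod n fs) = node n (children fs)
children [] = []
children (N · x + c ∷ fs) = (c , treeᴺ N) ∷ children fs

⟦_⟧ : Normal → Expr
product : ℕ → List Factor → Expr
⟦ prod n fs ⟧ = product n fs
product n [] = const n
product n (N · x + c ∷ fs) = lin ⟦ N ⟧ x c ⊗ product n fs

_⊛_ : Normal → Normal → Normal
prod n fs ⊛ prod m gs = prod (n * m) (fs ++ gs)

normalise : Expr → Normal
normalise (const n) = prod n []
normalise (E ⊗ F) = normalise E ⊛ normalise F
normalise (lin E x c) = prod 1 (normalise E · x + c ∷ [])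

children-++ : ∀ fs gs → children (fs ++ gs) ≡ children fs ++ children gs
children-++ [] gs = refl
children-++ (N · x + c ∷ fs) gs = cong ((c , treeᴺ N) ∷_) (children-++ fs gs)

treeMul-⊛ : ∀ A B → treeMul (treeᴺ A) (treeᴺ B) ≡ treeᴺ (A ⊛ B)
treeMul-⊛ (prod n fs) (prod m gs) = cong (node (n * m)) (sym (children-++ fs gs))

tree-normalise : ∀ E → tree E ≡ treeᴺ (normalise E)
tree-normalise (const n) = refl
tree-normalise (E ⊗ F) =
  trans (cong₂ treeMul (tree-normalise E) (tree-normalise F))
        (treeMul-⊛ (normalise E) (normalise F))
tree-normalise (lin E x c) = cong (λ T → node 1 ((c , T) ∷ [])) (tree-normalise E)

x⊗yz⇝y⊗xz : ∀ {E F G} → (E ⊗ (F ⊗ G)) ⇝ (F ⊗ (E ⊗ G))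
x⊗yz⇝y⊗xz = rootStep unassoc ◅◅ ⇝-⊗ˡ (rootStep comm) ◅◅ rootStep assoc

product-⊗ : ∀ n fs m gs → (product n fs ⊗ product m gs) ⇝ product (n * m) (fs ++ gs)
product-⊗ n [] m [] = rootStep fuse
product-⊗ n [] m (N · y + c ∷ gs) = x⊗yz⇝y⊗xz ◅◅ ⇝-⊗ʳ (product-⊗ n [] m gs)
product-⊗ n (N · x + c ∷ fs) m gs = rootStep assoc ◅◅ ⇝-⊗ʳ (product-⊗ n fs m gs)

⟦⟧-⊛ : ∀ A B → (⟦ A ⟧ ⊗ ⟦ B ⟧) ⇝ ⟦ A ⊛ B ⟧
⟦⟧-⊛ (prod n fs) (prod m gs) = product-⊗ n fs m gs

⇝-normalise : ∀ E → E ⇝ ⟦ normalise E ⟧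
⇝-normalise (const n) = ε
⇝-normalise (E ⊗ F) =
  ⇝-⊗ˡ (⇝-normalise E) ◅◅ ⇝-⊗ʳ (⇝-normalise F) ◅◅ ⟦⟧-⊛ (normalise E) (normalise F)
⇝-normalise (lin E x c) = ⇝-lin (⇝-normalise E) ◅◅ rootStep unitIntro ◅◅ rootStep comm

product-insert : ∀ n f fs₁ fs₂ → product n (f ∷ fs₁ ++ fs₂) ⇝ product n (fs₁ ++ f ∷ fs₂)
product-insert n f [] fs₂ = ε
product-insert n f@(_ · _ + _) (_ · _ + _ ∷ fs₁) fs₂ =
  x⊗yz⇝y⊗xz ◅◅ ⇝-⊗ʳ (product-insert n f fs₁ fs₂)

children-split : ∀ gs {ds₁ c u ds₂} → children gs ≡ ds₁ ++ (c , u) ∷ ds₂ →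
  ∃[ gs₁ ] ∃[ N ] ∃[ y ] ∃[ gs₂ ]
    gs ≡ gs₁ ++ N · y + c ∷ gs₂ × children gs₁ ≡ ds₁ × treeᴺ N ≡ u × children gs₂ ≡ ds₂
children-split [] {[]} ()
children-split [] {_ ∷ _} ()
children-split (N · y + c ∷ gs) {[]} refl = [] , N , y , gs , refl , refl , refl , refl
children-split (M · z + d ∷ gs) {_ ∷ ds₁} eq with List.∷-injective eq
... | refl , eq′ with children-split gs eq′
...   | gs₁ , N , y , gs₂ , refl , refl , refl , refl =
  M · z + d ∷ gs₁ , N , y , gs₂ , refl , refl , refl , refl

children-≅ᶜ-∷⁻ : ∀ {c t cs} gs → ((c , t) ∷ cs) ≅ᶜ children gs →
  ∃[ gs₁ ] ∃[ N ] ∃[ y ] ∃[ gs₂ ]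
    gs ≡ gs₁ ++ N · y + c ∷ gs₂ × t ≅ treeᴺ N × cs ≅ᶜ children (gs₁ ++ gs₂)
children-≅ᶜ-∷⁻ gs p with ≅ᶜ-remove [] p
... | ds₁ , ds₂ , u , eq , t≅u , q with children-split gs eq
...   | gs₁ , N , y , gs₂ , refl , refl , refl , refl =
  gs₁ , N , y , gs₂ , refl , t≅u , ≅ᶜ-resp-≡ (sym (children-++ gs₁ gs₂)) q

-- Rewriting up to a renaming that is injective on the variables

_[_↦_] : (ℕ → ℕ) → ℕ → ℕ → ℕ → ℕ
(f [ x ↦ y ]) z with z ≟ x
... | yes _ = y
... | no _ = f z

[↦]-same : ∀ f x y → (f [ x ↦ y ]) x ≡ y
[↦]-same f x y with x ≟ x
... | yes _ = refl
... | no x≢x = ⊥-elim (x≢x refl)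

[↦]-other : ∀ f {x y z} → ¬ z ≡ x → (f [ x ↦ y ]) z ≡ f z
[↦]-other f {x} {z = z} z≢x with z ≟ x
... | yes z≡x = ⊥-elim (z≢x z≡x)
... | no _ = refl

piecewise : List ℕ → (ℕ → ℕ) → (ℕ → ℕ) → ℕ → ℕ
piecewise A f g z with z ∈? A
... | yes _ = f z
... | no _ = g z

piecewise-∈ : ∀ A f g {z} → z ∈ A → piecewise A f g z ≡ f z
piecewise-∈ A f g {z} z∈A with z ∈? A
... | yes _ = refl
... | no z∉A = ⊥-elim (z∉A z∈A)

piecewise-∉ : ∀ A f g {z} → z ∉ A → piecewise A f g z ≡ g z
piecewise-∉ A f g {z} z∉A with z ∈? A
... | yes z∈A = ⊥-elim (z∉A z∈A)
... | no _ = refl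

rename-cong : ∀ ρ ρ′ E → (∀ {z} → z ∈ vars E → ρ z ≡ ρ′ z) → rename ρ E ≡ rename ρ′ E
rename-cong ρ ρ′ (const n) _ = refl
rename-cong ρ ρ′ (E ⊗ F) eq =
  cong₂ _⊗_ (rename-cong ρ ρ′ E (eq ∘ ∈-++⁺ˡ)) (rename-cong ρ ρ′ F (eq ∘ ∈-++⁺ʳ (vars E)))
rename-cong ρ ρ′ (lin E x c) eq =
  cong₂ (λ F y → lin F y c) (rename-cong ρ ρ′ E (eq ∘ there)) (eq (here refl))

∈-vars-rename : ∀ ρ E {z} → z ∈ vars E → ρ z ∈ vars (rename ρ E)
∈-vars-rename ρ (E ⊗ F) z∈ with ∈-++⁻ (vars E) z∈
... | inj₁ z∈E = ∈-++⁺ˡ (∈-vars-rename ρ E z∈E)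
... | inj₂ z∈F = ∈-++⁺ʳ (vars (rename ρ E)) (∈-vars-rename ρ F z∈F)
∈-vars-rename ρ (lin E x c) (here refl) = here refl
∈-vars-rename ρ (lin E x c) (there z∈E) = there (∈-vars-rename ρ E z∈E)

-- σ witnesses that ρ is injective on the variables of A, as move (5) requires.
record _⇝ʳ_ (A B : Expr) : Set where
  field
    ρ σ     : ℕ → ℕ
    σ∘ρ≗id : ∀ {z} → z ∈ vars A → σ (ρ z) ≡ z
    steps   : rename ρ A ⇝ B

open _⇝ʳ_

⇝ʳ-refl : ∀ {A} → A ⇝ʳ A
⇝ʳ-refl {A} = record
  { ρ = id ; σ = id ; σ∘ρ≗id = λ _ → refl ; steps = subst (_⇝ A) (sym (rename-id A)) ε }
  where
  rename-id : ∀ E → rename id E ≡ E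
  rename-id (const n) = refl
  rename-id (E ⊗ F) = cong₂ _⊗_ (rename-id E) (rename-id F)
  rename-id (lin E x c) = cong (λ F → lin F x c) (rename-id E)

⇝ʳ-⇝ : ∀ {A B C} → A ⇝ʳ B → B ⇝ C → A ⇝ʳ C
⇝ʳ-⇝ r s = record { ρ = ρ r ; σ = σ r ; σ∘ρ≗id = σ∘ρ≗id r ; steps = steps r ◅◅ s }

⇝ʳ-image : ∀ {A B} (r : A ⇝ʳ B) {z} → z ∈ vars A → ρ r z ∈ vars B
⇝ʳ-image {A} r = ⇝-vars⊆ (steps r) ∘ ∈-vars-rename (ρ r) A

⇝ʳ-lin : ∀ {A A′ x y c} → A ⇝ʳ A′ → x ∉ vars A → y ∉ vars A′ → lin A x c ⇝ʳ lin A′ y c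
⇝ʳ-lin {A} {A′} {x} {y} {c} r x∉A y∉A′ =
  record
    { ρ = ρ r [ x ↦ y ] ; σ = σ r [ y ↦ x ] ; σ∘ρ≗id = inverse
    ; steps = subst (_⇝ lin A′ y c) (sym renamed) (⇝-lin (steps r))
    }
  where
  ρ-on-A : ∀ {z} → z ∈ vars A → (ρ r [ x ↦ y ]) z ≡ ρ r z
  ρ-on-A z∈A = [↦]-other (ρ r) λ { refl → x∉A z∈A }

  inverse : ∀ {z} → z ∈ vars (lin A x c) → (σ r [ y ↦ x ]) ((ρ r [ x ↦ y ]) z) ≡ z
  inverse (here refl) = trans (cong (σ r [ y ↦ x ]) ([↦]-same (ρ r) x y)) ([↦]-same (σ r) y x)
  inverse {z} (there z∈A) = begin
    (σ r [ y ↦ x ]) ((ρ r [ x ↦ y ]) z) ≡⟨ cong (σ r [ y ↦ x ]) (ρ-on-A z∈A) ⟩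
    (σ r [ y ↦ x ]) (ρ r z)             ≡⟨ [↦]-other (σ r) (λ { refl → y∉A′ (⇝ʳ-image r z∈A) }) ⟩
    σ r (ρ r z)                         ≡⟨ σ∘ρ≗id r z∈A ⟩
    z                                   ∎
    where open ≡-Reasoning

  renamed : rename (ρ r [ x ↦ y ]) (lin A x c) ≡ lin (rename (ρ r) A) y c
  renamed = cong₂ (λ F w → lin F w c) (rename-cong _ (ρ r) A ρ-on-A) ([↦]-same (ρ r) x y)

⇝ʳ-⊗ : ∀ {L L′ R R′} → L ⇝ʳ L′ → R ⇝ʳ R′ → Disjoint L R → Disjoint L′ R′ → (L ⊗ R) ⇝ʳ (L′ ⊗ R′)
⇝ʳ-⊗ {L} {L′} {R} {R′} l r dLR dL′R′ =
  record
    { ρ = ρ′ ; σ = σ′ ; σ∘ρ≗id = inverse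
    ; steps = subst (_⇝ (L′ ⊗ R′)) (sym renamed) (⇝-⊗ˡ (steps l) ◅◅ ⇝-⊗ʳ (steps r))
    }
  where
  ρ′ σ′ : ℕ → ℕ
  ρ′ = piecewise (vars L) (ρ l) (ρ r)
  σ′ = piecewise (vars L′) (σ l) (σ r)

  ρ′-on-L : ∀ {z} → z ∈ vars L → ρ′ z ≡ ρ l z
  ρ′-on-L = piecewise-∈ (vars L) (ρ l) (ρ r)

  ρ′-on-R : ∀ {z} → z ∈ vars R → ρ′ z ≡ ρ r z
  ρ′-on-R z∈R = piecewise-∉ (vars L) (ρ l) (ρ r) (λ z∈L → dLR z∈L z∈R)

  inverse : ∀ {z} → z ∈ vars (L ⊗ R) → σ′ (ρ′ z) ≡ z
  inverse z∈LR with ∈-++⁻ (vars L) z∈LR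
  ... | inj₁ z∈L rewrite ρ′-on-L z∈L =
    trans (piecewise-∈ (vars L′) (σ l) (σ r) (⇝ʳ-image l z∈L)) (σ∘ρ≗id l z∈L)
  ... | inj₂ z∈R rewrite ρ′-on-R z∈R =
    trans (piecewise-∉ (vars L′) (σ l) (σ r) (λ w∈L′ → dL′R′ w∈L′ (⇝ʳ-image r z∈R))) (σ∘ρ≗id r z∈R)

  renamed : rename ρ′ (L ⊗ R) ≡ rename (ρ l) L ⊗ rename (ρ r) R
  renamed = cong₂ _⊗_ (rename-cong ρ′ (ρ l) L ρ′-on-L) (rename-cong ρ′ (ρ r) R ρ′-on-R)

⇝ʳ⇒Moves : ∀ {A B} → A ⇝ʳ B → Star Move A B
⇝ʳ⇒Moves {A} r = renameAll (ρ r) injective ◅ ⇝⇒Moves (steps r)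
  where
  injective : ∀ {a b} → a ∈ vars A → b ∈ vars A → ρ r a ≡ ρ r b → a ≡ b
  injective a∈ b∈ e = trans (sym (σ∘ρ≗id r a∈)) (trans (cong (σ r) e) (σ∘ρ≗id r b∈))

≅⇒⇝ʳ : ∀ N N′ → treeᴺ N ≅ treeᴺ N′ → LowDefect ⟦ N ⟧ → LowDefect ⟦ N′ ⟧ → ⟦ N ⟧ ⇝ʳ ⟦ N′ ⟧
≅ᶜ⇒⇝ʳ : ∀ n fs gs → children fs ≅ᶜ children gs →
  LowDefect (product n fs) → LowDefect (product n gs) → product n fs ⇝ʳ product n gs

≅⇒⇝ʳ (prod n fs) (prod _ gs) (node p) = ≅ᶜ⇒⇝ʳ n fs gs p

≅ᶜ⇒⇝ʳ n [] [] _ _ _ = ⇝ʳ-refl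
≅ᶜ⇒⇝ʳ n [] (_ · _ + _ ∷ _) () _ _
≅ᶜ⇒⇝ʳ n (N · x + c ∷ fs) gs p (ld-mul (ld-lin ldN _ x∉N) ldfs dfs) ldgs
  with children-≅ᶜ-∷⁻ gs p
... | gs₁ , N′ , y , gs₂ , refl , N≅N′ , fs≅gs
  with LowDefect-⇝ (⇝-sym (product-insert n (N′ · y + c) gs₁ gs₂)) ldgs
...   | ld-mul (ld-lin ldN′ _ y∉N′) ldgs′ dgs =
  ⇝ʳ-⇝ (⇝ʳ-⊗ (⇝ʳ-lin (≅⇒⇝ʳ N N′ N≅N′ ldN ldN′) x∉N y∉N′)
              (≅ᶜ⇒⇝ʳ n fs (gs₁ ++ gs₂) fs≅gs ldfs ldgs′) dfs dgs)
       (product-insert n (N′ · y + c) gs₁ gs₂)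

proposition3p7 : ∀ (E E′ : Expr) → LowDefect E → LowDefect E′ →
    (tree E ≅ tree E′) ⇔ Star Move E E′
proposition3p7 E E′ ldE ldE′ = mk⇔ complete Moves⇒≅
  where
  complete : tree E ≅ tree E′ → Star Move E E′
  complete E≅E′ =
    ⇝⇒Moves (⇝-normalise E) ◅◅
    ⇝ʳ⇒Moves (≅⇒⇝ʳ (normalise E) (normalise E′)
                (subst₂ _≅_ (tree-normalise E) (tree-normalise E′) E≅E′)
                (LowDefect-⇝ (⇝-normalise E) ldE) (LowDefect-⇝ (⇝-normalise E′) ldE′)) ◅◅
    ⇝⇒Moves (⇝-sym (⇝-normalise E′))
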